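{- Let $n,m$ be positive integers. There exists a Type I solution $(x,y,z)\in\mathbb N^3$ of $\frac mn=\frac1x+\frac1y+\frac1z$ if and only if there exist $a,d,f\in\mathbb N$ with $f\mid ma^2d+1$, $mad\mid n+f$, and $(n+f)/(mad)$ coprime to $n$.
   Context: $\mathbb N$ denotes the positive integers. A solution $(x,y,z)\in\mathbb N^3$ of $\frac mn=\frac1x+\frac1y+\frac1z$ is of Type I if $n$ divides $x$ but $n$ is coprime to $y$ and to $z$. -}

module Defs where

open import Data.Nat using (ℕ; _+_; _*_; _^_)
open import Data.Nat.Divisibility using (_∣_)
open import Data.Nat.Coprimality using (Coprime)
open import Data.Product using (_×_)
open import Relation.Binary.PropositionalEquality using (_≡_)
open import Relation.Nullary using (¬_)

-- positivity (the paper's ℕ is the positive integers)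
Pos : ℕ → Set
Pos k = ¬ (k ≡ 0)

-- (x,y,z) solves m/n = 1/x + 1/y + 1/z  (all positive), cleared of denominators:
-- m x y z = n (y z + x z + x y)
IsSolution : ℕ → ℕ → ℕ → ℕ → ℕ → Set
IsSolution m n x y z =
  Pos x × Pos y × Pos z × (m * x * y * z ≡ n * (y * z + x * z + x * y))

TypeI : ℕ → ℕ → ℕ → ℕ → ℕ → Set
TypeI m n x y z = IsSolution m n x y z × n ∣ x × Coprime n y × Coprime n z

{-# OPTIONS --safe #-}
-- Write x = n x′, y = a g and z = c g with g = gcd y z. Dividing by n g gives
-- m x′ a c g = a c g + n x′ (a + c); since a and c are coprime to n, to a + c and to each other,
-- a c ∣ x′, say x′ = d a c. Dividing by a c then shows d ∣ g, say g = q d, and leaves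
--   m a c d q = q + n (a + c)   with q coprime to n.
-- Conversely such a, c, d, q give the Type I solution (a c d n, a d q, c d q): q ∣ a + c = s q
-- forces m a c d = 1 + n s, so n is coprime to a, c and d.
-- These parameters match the criterion through f = m a d q − n: then f (a + c) = q (m a² d + 1),
-- so f s = m a² d + 1; conversely c = q s − a.
module Submission where

open import Defs
open import Data.Nat using (ℕ; _+_; _*_; _^_)
open import Data.Nat.Divisibility using (_∣_)
open import Data.Nat.Coprimality using (Coprime)
open import Data.Product using (_×_; Σ; ∃-syntax)
open import Relation.Binary.PropositionalEquality using (_≡_)
open import Function.Bundles using (_⇔_)

open import Data.List using (_∷_; [])
open import Data.Nat using (_≤_; _<_; _∸_; ≢-nonZero)
open import Data.Nat.Coprimality as Coprimality
  using (coprime-divisor; coprime-+; coprime-/gcd)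
open import Data.Nat.Divisibility
  using (divides; ∣-refl; ∣-trans; ∣1⇒≡1; ∣m+n∣m⇒∣n; m∣m*n; n∣m*n; n∣m*n*o; *-monoˡ-∣)
open import Data.Nat.DivMod using (_/_; m/n*n≡m)
open import Data.Nat.GCD using (gcd; gcd[m,n]∣m; gcd[m,n]∣n; gcd[m,n]≢0)
open import Data.Nat.Properties
open import Data.Nat.Tactic.RingSolver using (solve)
open import Data.Product using (_,_)
open import Data.Sum using (inj₁; [_,_]′)
open import Function.Bundles using (mk⇔)
open import Relation.Binary.PropositionalEquality
  using (refl; sym; trans; cong; subst; module ≡-Reasoning)

m^2≡m*m : ∀ m → m ^ 2 ≡ m * m
m^2≡m*m m = cong (m *_) (*-identityʳ m)

Pos-* : ∀ {a b} → Pos a → Pos b → Pos (a * b)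
Pos-* {a} a≢0 b≢0 ab≡0 = [ a≢0 , b≢0 ]′ (m*n≡0⇒m≡0∨n≡0 a ab≡0)

Pos-*⇒Posˡ : ∀ {a} b → Pos (a * b) → Pos a
Pos-*⇒Posˡ b ab≢0 refl = ab≢0 refl

coprime-∣ʳ : ∀ {n t u} → Coprime n t → u ∣ t → Coprime n u
coprime-∣ʳ n⊥t u∣t (d∣n , d∣u) = n⊥t (d∣n , ∣-trans d∣u u∣t)

coprime-*ʳ : ∀ {n u v} → Coprime n u → Coprime n v → Coprime n (u * v)
coprime-*ʳ {n} {u} n⊥u n⊥v {d} (d∣n , d∣uv) = n⊥v (d∣n , coprime-divisor d⊥u d∣uv)
  where
  d⊥u : Coprime d u
  d⊥u (e∣d , e∣u) = n⊥u (∣-trans e∣d d∣n , e∣u)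

coprime[n,1+n*k] : ∀ n k → Coprime n (1 + n * k)
coprime[n,1+n*k] n k {d} (d∣n , d∣1+nk) =
  ∣1⇒≡1 (∣m+n∣m⇒∣n (subst (d ∣_) (+-comm 1 (n * k)) d∣1+nk) (∣-trans d∣n (m∣m*n k)))

coprime-∣⇒*∣ : ∀ {a c k} → Coprime a c → a ∣ k → c ∣ k → a * c ∣ k
coprime-∣⇒*∣ {a} {c} a⊥c (divides u refl) c∣ua =
  subst (_∣ u * a) (*-comm c a) (*-monoˡ-∣ a c∣u)
  where
  c∣u : c ∣ u
  c∣u = coprime-divisor (Coprimality.sym a⊥c) (subst (c ∣_) (*-comm u a) c∣ua)

coprime-cofactors : ∀ y z → Pos y →
  ∃[ a ] ∃[ c ] ∃[ g ] (y ≡ a * g × z ≡ c * g × Pos g × Coprime a c)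
coprime-cofactors y z y≢0 =
  y / g , z / g , g ,
  sym (m/n*n≡m (gcd[m,n]∣m y z)) , sym (m/n*n≡m (gcd[m,n]∣n y z)) , g≢0 , coprime-/gcd y z
  where
  g = gcd y z
  g≢0 : Pos g
  g≢0 = gcd[m,n]≢0 y z (inj₁ y≢0)
  instance
    g-nonZero = ≢-nonZero g≢0

record TypeIParameters (m n : ℕ) : Set where
  constructor parameters
  field
    a c d q : ℕ
    a≢0 : Pos a
    c≢0 : Pos c
    d≢0 : Pos d
    q≢0 : Pos q
    q⊥n : Coprime q n
    equation : m * a * c * d * q ≡ q + n * (a + c)

q∣a+c : ∀ {m n a c d q} → Coprime q n → m * a * c * d * q ≡ q + n * (a + c) → q ∣ a + c
q∣a+c {m} {a = a} {c} {d} {q} q⊥n equation = coprime-divisor q⊥n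
  (∣m+n∣m⇒∣n (subst (q ∣_) equation (n∣m*n (m * a * c * d))) ∣-refl)

q+n*t≡[1+n*s]*q : ∀ n {t s q} → t ≡ s * q → q + n * t ≡ (1 + n * s) * q
q+n*t≡[1+n*s]*q n {s = s} {q} refl = solve (n ∷ s ∷ q ∷ [])

coprime[n,m*a*c*d] : ∀ {m n a c d q} → Pos q → Coprime q n →
  m * a * c * d * q ≡ q + n * (a + c) → Coprime n (m * a * c * d)
coprime[n,m*a*c*d] {m} {n} {a} {c} {d} {q} q≢0 q⊥n equation
  with q∣a+c {m} {d = d} q⊥n equation
... | divides s a+c≡s*q = subst (Coprime n) (sym m*a*c*d≡1+n*s) (coprime[n,1+n*k] n s)
  where
  m*a*c*d≡1+n*s : m * a * c * d ≡ 1 + n * s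
  m*a*c*d≡1+n*s = *-cancelʳ-≡ (m * a * c * d) (1 + n * s) q {{≢-nonZero q≢0}}
    (trans equation (q+n*t≡[1+n*s]*q n a+c≡s*q))

parameters⇒typeI : ∀ {m n} → Pos n → TypeIParameters m n →
  ∃[ x ] ∃[ y ] ∃[ z ] TypeI m n x y z
parameters⇒typeI {m} {n} n≢0 (parameters a c d q a≢0 c≢0 d≢0 q≢0 q⊥n equation) =
  a * c * d * n , a * d * q , c * d * q ,
  ( Pos-* (Pos-* (Pos-* a≢0 c≢0) d≢0) n≢0
  , Pos-* (Pos-* a≢0 d≢0) q≢0
  , Pos-* (Pos-* c≢0 d≢0) q≢0
  , solution) ,
  divides (a * c * d) refl ,
  coprime-*ʳ (coprime-*ʳ n⊥a n⊥d) n⊥q ,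
  coprime-*ʳ (coprime-*ʳ n⊥c n⊥d) n⊥q
  where
  n⊥macd : Coprime n (m * a * c * d)
  n⊥macd = coprime[n,m*a*c*d] {m} {d = d} q≢0 q⊥n equation
  n⊥a : Coprime n a
  n⊥a = coprime-∣ʳ {u = a} n⊥macd (divides (m * c * d) (solve (m ∷ a ∷ c ∷ d ∷ [])))
  n⊥c : Coprime n c
  n⊥c = coprime-∣ʳ {u = c} n⊥macd (divides (m * a * d) (solve (m ∷ a ∷ c ∷ d ∷ [])))
  n⊥d : Coprime n d
  n⊥d = coprime-∣ʳ n⊥macd (divides (m * a * c) refl)
  n⊥q : Coprime n q
  n⊥q = Coprimality.sym q⊥n
  solution : m * (a * c * d * n) * (a * d * q) * (c * d * q)
           ≡ n * (a * d * q * (c * d * q) + a * c * d * n * (c * d * q)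
                  + a * c * d * n * (a * d * q))
  solution = begin
    m * (a * c * d * n) * (a * d * q) * (c * d * q)  ≡⟨ solve (m ∷ n ∷ a ∷ c ∷ d ∷ q ∷ []) ⟩
    n * a * c * d * d * q * (m * a * c * d * q)      ≡⟨ cong (n * a * c * d * d * q *_) equation ⟩
    n * a * c * d * d * q * (q + n * (a + c))        ≡⟨ solve (m ∷ n ∷ a ∷ c ∷ d ∷ q ∷ []) ⟩
    n * (a * d * q * (c * d * q) + a * c * d * n * (c * d * q)
         + a * c * d * n * (a * d * q))              ∎
    where open ≡-Reasoning

cofactor∣x′ : ∀ {m n x′ a c g} → Coprime n (a * g) → Coprime a c →
  m * x′ * a * c * g ≡ a * c * g + n * x′ * (a + c) → a ∣ x′
cofactor∣x′ {m} {n} {x′} {a} {c} {g} n⊥ag a⊥c cleared =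
  coprime-divisor a⊥a+c (subst (a ∣_) (*-comm x′ (a + c)) (coprime-divisor a⊥n a∣n*x′*[a+c]))
  where
  a⊥n : Coprime a n
  a⊥n = Coprimality.sym (coprime-∣ʳ n⊥ag (m∣m*n g))
  a⊥a+c : Coprime a (a + c)
  a⊥a+c = Coprimality.sym (coprime-+ (Coprimality.sym a⊥c))
  a∣n*x′*[a+c] : a ∣ n * (x′ * (a + c))
  a∣n*x′*[a+c] = subst (a ∣_) (*-assoc n x′ (a + c))
    (∣m+n∣m⇒∣n (subst (a ∣_) cleared (∣-trans (n∣m*n*o (m * x′) c) (m∣m*n g)))
               (∣-trans (m∣m*n c) (m∣m*n g)))

a*c∣x′ : ∀ {m n x′ a c g} → Coprime n (a * g) → Coprime n (c * g) → Coprime a c →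
  m * x′ * a * c * g ≡ a * c * g + n * x′ * (a + c) → a * c ∣ x′
a*c∣x′ {m} {n} {x′} {a} {c} {g} n⊥ag n⊥cg a⊥c cleared =
  coprime-∣⇒*∣ a⊥c (cofactor∣x′ {m} n⊥ag a⊥c cleared)
                   (cofactor∣x′ {m} n⊥cg (Coprimality.sym a⊥c) cleared′)
  where
  cleared′ : m * x′ * c * a * g ≡ c * a * g + n * x′ * (c + a)
  cleared′ = begin
    m * x′ * c * a * g            ≡⟨ solve (m ∷ x′ ∷ a ∷ c ∷ g ∷ []) ⟩
    m * x′ * a * c * g            ≡⟨ cleared ⟩
    a * c * g + n * x′ * (a + c)  ≡⟨ solve (n ∷ x′ ∷ a ∷ c ∷ g ∷ []) ⟩
    c * a * g + n * x′ * (c + a)  ∎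
    where open ≡-Reasoning

d∣g : ∀ {m n a c d g} → m * a * c * d * g ≡ g + n * d * (a + c) → d ∣ g
d∣g {m} {n} {a} {c} {d} {g} scaled =
  ∣m+n∣m⇒∣n (subst (d ∣_) (trans scaled (+-comm g _)) d∣m*a*c*d*g) (n∣m*n*o n (a + c))
  where
  d∣m*a*c*d*g : d ∣ m * a * c * d * g
  d∣m*a*c*d*g = ∣-trans (n∣m*n (m * a * c)) (m∣m*n g)

scaled-equation⇒parameters : ∀ {m n a c d g} → Pos a → Pos c → Pos d → Pos g →
  Coprime n (a * g) → m * a * c * d * g ≡ g + n * d * (a + c) → TypeIParameters m n
scaled-equation⇒parameters {m} {n} {a} {c} {d} {g} a≢0 c≢0 d≢0 g≢0 n⊥ag scaled
  with d∣g {m} {n} {a} {c} scaled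
... | divides q refl =
  parameters a c d q a≢0 c≢0 d≢0 (Pos-*⇒Posˡ d g≢0) q⊥n equation
  where
  q⊥n : Coprime q n
  q⊥n = Coprimality.sym (coprime-∣ʳ n⊥ag (∣-trans (m∣m*n d) (n∣m*n a)))
  equation : m * a * c * d * q ≡ q + n * (a + c)
  equation = *-cancelʳ-≡ _ _ d {{≢-nonZero d≢0}} (begin
    m * a * c * d * q * d          ≡⟨ solve (m ∷ a ∷ c ∷ d ∷ q ∷ []) ⟩
    m * a * c * d * (q * d)        ≡⟨ scaled ⟩
    q * d + n * d * (a + c)        ≡⟨ solve (n ∷ a ∷ c ∷ d ∷ q ∷ []) ⟩
    (q + n * (a + c)) * d          ∎)
    where open ≡-Reasoning

cleared-equation⇒parameters : ∀ {m n x′ a c g} → Pos x′ → Pos a → Pos c → Pos g →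
  Coprime n (a * g) → Coprime n (c * g) → Coprime a c →
  m * x′ * a * c * g ≡ a * c * g + n * x′ * (a + c) → TypeIParameters m n
cleared-equation⇒parameters {m} {n} {x′} {a} {c} {g}
  x′≢0 a≢0 c≢0 g≢0 n⊥ag n⊥cg a⊥c cleared
  with a*c∣x′ {m} n⊥ag n⊥cg a⊥c cleared
... | divides d refl =
  scaled-equation⇒parameters a≢0 c≢0 (Pos-*⇒Posˡ (a * c) x′≢0) g≢0 n⊥ag scaled
  where
  scaled : m * a * c * d * g ≡ g + n * d * (a + c)
  scaled = *-cancelˡ-≡ _ _ (a * c) {{≢-nonZero (Pos-* a≢0 c≢0)}} (begin
    a * c * (m * a * c * d * g)                ≡⟨ solve (m ∷ a ∷ c ∷ d ∷ g ∷ []) ⟩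
    m * (d * (a * c)) * a * c * g              ≡⟨ cleared ⟩
    a * c * g + n * (d * (a * c)) * (a + c)    ≡⟨ solve (n ∷ a ∷ c ∷ d ∷ g ∷ []) ⟩
    a * c * (g + n * d * (a + c))              ∎)
    where open ≡-Reasoning

typeI⇒parameters : ∀ {m n x y z} → Pos n → TypeI m n x y z → TypeIParameters m n
typeI⇒parameters {m} {n} {y = y} {z} n≢0
  ((x≢0 , y≢0 , z≢0 , solution) , divides x′ refl , n⊥y , n⊥z)
  with coprime-cofactors y z y≢0
... | a , c , g , refl , refl , g≢0 , a⊥c =
  cleared-equation⇒parameters (Pos-*⇒Posˡ n x≢0) (Pos-*⇒Posˡ g y≢0) (Pos-*⇒Posˡ g z≢0) g≢0
    n⊥y n⊥z a⊥c cleared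
  where
  cleared : m * x′ * a * c * g ≡ a * c * g + n * x′ * (a + c)
  cleared = *-cancelˡ-≡ _ _ (n * g) {{≢-nonZero (Pos-* n≢0 g≢0)}} (begin
    n * g * (m * x′ * a * c * g)
      ≡⟨ solve (m ∷ n ∷ x′ ∷ a ∷ c ∷ g ∷ []) ⟩
    m * (x′ * n) * (a * g) * (c * g)
      ≡⟨ solution ⟩
    n * (a * g * (c * g) + x′ * n * (c * g) + x′ * n * (a * g))
      ≡⟨ solve (m ∷ n ∷ x′ ∷ a ∷ c ∷ g ∷ []) ⟩
    n * g * (a * c * g + n * x′ * (a + c))
      ∎)
    where open ≡-Reasoning

Criterion : ℕ → ℕ → Set
Criterion n m = ∃[ a ] ∃[ d ] ∃[ f ] (Pos a × Pos d × Pos f ×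
  f ∣ m * a ^ 2 * d + 1 ×
  m * a * d ∣ n + f ×
  (∀ q → n + f ≡ m * a * d * q → Coprime q n))

n≤m*a*d*q : ∀ {m n a c d q} → Pos c →
  m * a * c * d * q ≡ q + n * (a + c) → n ≤ m * a * d * q
n≤m*a*d*q {m} {n} {a} {c} {d} {q} c≢0 equation =
  *-cancelʳ-≤ n (m * a * d * q) c {{≢-nonZero c≢0}} (begin
    n * c              ≤⟨ *-monoʳ-≤ n (m≤n+m c a) ⟩
    n * (a + c)        ≤⟨ m≤n+m (n * (a + c)) q ⟩
    q + n * (a + c)    ≡⟨ equation ⟨
    m * a * c * d * q  ≡⟨ solve (m ∷ a ∷ c ∷ d ∷ q ∷ []) ⟩
    m * a * d * q * c  ∎)
  where open ≤-Reasoning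

parameters⇒criterion : ∀ {m n} → Pos m → TypeIParameters m n → Criterion n m
parameters⇒criterion {m} {n} m≢0 (parameters a c d q a≢0 c≢0 d≢0 q≢0 q⊥n equation)
  with q∣a+c {m} {d = d} q⊥n equation | m≤n⇒∃[o]m+o≡n (n≤m*a*d*q {m} c≢0 equation)
... | divides s a+c≡s*q | f , n+f≡m*a*d*q =
  a , d , f , a≢0 , d≢0 , f≢0 , divides s m*a²*d+1≡s*f ,
  divides q (trans n+f≡m*a*d*q (*-comm (m * a * d) q)) , q′⊥n
  where
  f*[a+c]≡q*[m*a*a*d+1] : f * (a + c) ≡ q * (m * (a * a) * d + 1)
  f*[a+c]≡q*[m*a*a*d+1] = +-cancelˡ-≡ (n * (a + c)) _ _ (begin
    n * (a + c) + f * (a + c)                  ≡⟨ *-distribʳ-+ (a + c) n f ⟨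
    (n + f) * (a + c)                          ≡⟨ cong (_* (a + c)) n+f≡m*a*d*q ⟩
    m * a * d * q * (a + c)                    ≡⟨ solve (m ∷ a ∷ c ∷ d ∷ q ∷ []) ⟩
    m * a * c * d * q + q * (m * (a * a) * d)  ≡⟨ cong (_+ q * (m * (a * a) * d)) equation ⟩
    q + n * (a + c) + q * (m * (a * a) * d)    ≡⟨ solve (m ∷ n ∷ a ∷ c ∷ d ∷ q ∷ []) ⟩
    n * (a + c) + q * (m * (a * a) * d + 1)    ∎)
    where open ≡-Reasoning
  m*a²*d+1≡s*f : m * a ^ 2 * d + 1 ≡ s * f
  m*a²*d+1≡s*f = *-cancelʳ-≡ _ _ q {{≢-nonZero q≢0}} (begin
    (m * a ^ 2 * d + 1) * q      ≡⟨ cong (λ t → (m * t * d + 1) * q) (m^2≡m*m a) ⟩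
    (m * (a * a) * d + 1) * q    ≡⟨ *-comm _ q ⟩
    q * (m * (a * a) * d + 1)    ≡⟨ f*[a+c]≡q*[m*a*a*d+1] ⟨
    f * (a + c)                  ≡⟨ cong (f *_) a+c≡s*q ⟩
    f * (s * q)                  ≡⟨ solve (f ∷ s ∷ q ∷ []) ⟩
    s * f * q                    ∎)
    where open ≡-Reasoning
  f≢0 : Pos f
  f≢0 f≡0 = Pos-* q≢0 (m+1+n≢0 (m * (a * a) * d))
    (trans (sym f*[a+c]≡q*[m*a*a*d+1]) (cong (_* (a + c)) f≡0))
  q′⊥n : ∀ q′ → n + f ≡ m * a * d * q′ → Coprime q′ n
  q′⊥n q′ n+f≡m*a*d*q′ = subst (λ t → Coprime t n) q≡q′ q⊥n
    where
    q≡q′ : q ≡ q′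
    q≡q′ = *-cancelˡ-≡ q q′ (m * a * d) {{≢-nonZero (Pos-* (Pos-* m≢0 a≢0) d≢0)}}
      (trans (sym n+f≡m*a*d*q) n+f≡m*a*d*q′)

q*s*f≡q+a*[n+f] : ∀ {m n a d f s q} →
  m * (a * a) * d + 1 ≡ s * f → n + f ≡ q * (m * a * d) → q * s * f ≡ q + a * (n + f)
q*s*f≡q+a*[n+f] {m} {n} {a} {d} {f} {s} {q} m*a*a*d+1≡s*f n+f≡q*m*a*d = begin
  q * s * f                     ≡⟨ *-assoc q s f ⟩
  q * (s * f)                   ≡⟨ cong (q *_) m*a*a*d+1≡s*f ⟨
  q * (m * (a * a) * d + 1)     ≡⟨ solve (m ∷ a ∷ d ∷ q ∷ []) ⟩
  q + a * (q * (m * a * d))     ≡⟨ cong (λ t → q + a * t) n+f≡q*m*a*d ⟨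
  q + a * (n + f)               ∎
  where open ≡-Reasoning

m*a*c*d≡1+n*s : ∀ {m n a c d f s q} → Pos f →
  m * (a * a) * d + 1 ≡ s * f → n + f ≡ q * (m * a * d) → c * f ≡ q + a * n →
  m * a * c * d ≡ 1 + n * s
m*a*c*d≡1+n*s {m} {n} {a} {c} {d} {f} {s} {q} f≢0 m*a*a*d+1≡s*f n+f≡q*m*a*d c*f≡q+a*n =
  *-cancelˡ-≡ _ _ f {{≢-nonZero f≢0}} (begin
    f * (m * a * c * d)                      ≡⟨ solve (m ∷ a ∷ c ∷ d ∷ f ∷ []) ⟩
    m * a * d * (c * f)                      ≡⟨ cong (m * a * d *_) c*f≡q+a*n ⟩
    m * a * d * (q + a * n)                  ≡⟨ solve (m ∷ n ∷ a ∷ d ∷ q ∷ []) ⟩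
    q * (m * a * d) + n * (m * (a * a) * d)  ≡⟨ cong (_+ n * (m * (a * a) * d)) n+f≡q*m*a*d ⟨
    n + f + n * (m * (a * a) * d)            ≡⟨ solve (m ∷ n ∷ a ∷ d ∷ f ∷ []) ⟩
    f + n * (m * (a * a) * d + 1)            ≡⟨ cong (λ t → f + n * t) m*a*a*d+1≡s*f ⟩
    f + n * (s * f)                          ≡⟨ solve (n ∷ f ∷ s ∷ []) ⟩
    f * (1 + n * s)                          ∎)
  where open ≡-Reasoning

criterion⇒parameters : ∀ {m n} → Criterion n m → TypeIParameters m n
criterion⇒parameters {m} {n}
  (a , d , f , a≢0 , d≢0 , f≢0 , divides s m*a²*d+1≡s*f , divides q n+f≡q*m*a*d , q′⊥n) =
  parameters a c d q a≢0 c≢0 d≢0 q≢0 (q′⊥n q (trans n+f≡q*m*a*d (*-comm q (m * a * d))))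
    equation
  where
  m*a*a*d+1≡s*f : m * (a * a) * d + 1 ≡ s * f
  m*a*a*d+1≡s*f = trans (cong (λ t → m * t * d + 1) (sym (m^2≡m*m a))) m*a²*d+1≡s*f
  q≢0 : Pos q
  q≢0 q≡0 = f≢0 (m+n≡0⇒n≡0 n (trans n+f≡q*m*a*d (cong (_* (m * a * d)) q≡0)))
  q*s*f≡q+a*[n+f]′ : q * s * f ≡ q + a * (n + f)
  q*s*f≡q+a*[n+f]′ = q*s*f≡q+a*[n+f] {m} {a = a} m*a*a*d+1≡s*f n+f≡q*m*a*d
  a<q*s : a < q * s
  a<q*s = *-cancelʳ-< f a (q * s) (begin-strict
    a * f            ≤⟨ *-monoʳ-≤ a (m≤n+m f n) ⟩
    a * (n + f)      <⟨ m<n+m (a * (n + f)) (n≢0⇒n>0 q≢0) ⟩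
    q + a * (n + f)  ≡⟨ q*s*f≡q+a*[n+f]′ ⟨
    q * s * f        ∎)
    where open ≤-Reasoning
  c : ℕ
  c = q * s ∸ a
  a+c≡q*s : a + c ≡ q * s
  a+c≡q*s = m+[n∸m]≡n (<⇒≤ a<q*s)
  c≢0 : Pos c
  c≢0 = n>0⇒n≢0 (m<n⇒0<n∸m a<q*s)
  c*f≡q+a*n : c * f ≡ q + a * n
  c*f≡q+a*n = +-cancelˡ-≡ (a * f) _ _ (begin
    a * f + c * f        ≡⟨ *-distribʳ-+ f a c ⟨
    (a + c) * f          ≡⟨ cong (_* f) a+c≡q*s ⟩
    q * s * f            ≡⟨ q*s*f≡q+a*[n+f]′ ⟩
    q + a * (n + f)      ≡⟨ solve (n ∷ a ∷ f ∷ q ∷ []) ⟩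
    a * f + (q + a * n)  ∎)
    where open ≡-Reasoning
  equation : m * a * c * d * q ≡ q + n * (a + c)
  equation = begin
    m * a * c * d * q
      ≡⟨ cong (_* q) (m*a*c*d≡1+n*s {m} {c = c} f≢0 m*a*a*d+1≡s*f n+f≡q*m*a*d c*f≡q+a*n) ⟩
    (1 + n * s) * q
      ≡⟨ q+n*t≡[1+n*s]*q n (trans a+c≡q*s (*-comm q s)) ⟨
    q + n * (a + c)
      ∎
    where open ≡-Reasoning

proposition2p1 : (n m : ℕ) → Pos n → Pos m →
    (∃[ x ] ∃[ y ] ∃[ z ] TypeI m n x y z)
    ⇔ (∃[ a ] ∃[ d ] ∃[ f ] (Pos a × Pos d × Pos f ×
         f ∣ m * a ^ 2 * d + 1 ×
         m * a * d ∣ n + f ×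
         (∀ q → n + f ≡ m * a * d * q → Coprime q n)))
proposition2p1 n m n≢0 m≢0 = mk⇔
  (λ (_ , _ , _ , typeI) → parameters⇒criterion m≢0 (typeI⇒parameters n≢0 typeI))
  (λ criterion → parameters⇒typeI n≢0 (criterion⇒parameters {m} {n} criterion))
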